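{- Let $X=\{\ell_1,\dots,\ell_p\}$ be a festoon with its links numbered according to the festoon order. Then for all $i,j$ with $i<j-1$, the vertex $\mathrm{right}(\ell_i)$ is to the left of the vertex $\mathrm{left}(\ell_j)$.
   Context: Setting: a cycle $G=(V,E)$ with root $r$ and an edge $e_r\in E$ incident to $r$; links are unordered vertex pairs. Number $V=\{r=v_0,\dots,v_{n-1}\}$ along the path $(V,E\setminus\{e_r\})$ starting at $r$; $v_i$ is to the left of $v_j$ if $i<j$. For a link $\ell$, $\mathrm{left}(\ell)$ and $\mathrm{right}(\ell)$ are its left and right endpoints. Two links intersect if they share an endpoint or cross (share no endpoint and each of the two paths of $G$ between the endpoints of one contains an endpoint of the other); the link intersection graph $H[X]$ of a link set $X$ has vertex set $X$ and edges between intersecting links. A link set $X$ is a festoon if $H[X]$ is a path and its links can be numbered $\ell_1,\dots,\ell_p$ such that the path visits them in this order, and for all $i<j$, $\mathrm{left}(\ell_i)$ is to the left of $\mathrm{left}(\ell_j)$ and $\mathrm{right}(\ell_i)$ is to the left of $\mathrm{right}(\ell_j)$; this numbering is the festoon order. -}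

module Defs where

open import Data.Nat using (ℕ; suc; _≥_)
open import Data.Fin using (Fin; toℕ; _<_)
open import Data.Product using (_×_; ∃)
open import Data.Sum using (_⊎_)
open import Relation.Binary.PropositionalEquality using (_≡_; _≢_)
open import Relation.Nullary using (¬_)
open import Function.Bundles using (_⇔_)

-- Vertices are Fin n, where the vertex
-- with index i is v_i of the numbering along the path (V, E \ {e_r})
-- starting at the root r = v_0; so e_r = {v_{n-1}, v_0} and the other
-- edges are {v_i, v_{i+1}}.  "v_i is to the left of v_j" is i < j.

-- A link is an unordered pair of distinct vertices, stored by its left
-- and right endpoint.
record Link (n : ℕ) : Set where
  constructor link
  field
    left  : Fin n
    right : Fin n
    left<right : left < right
open Link public

_isEndOf_ : ∀ {n} → Fin n → Link n → Set
x isEndOf ℓ = (x ≡ left ℓ) ⊎ (x ≡ right ℓ)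

ShareEndpoint : ∀ {n} → Link n → Link n → Set
ShareEndpoint ℓ ℓ' = ∃ λ x → x isEndOf ℓ × x isEndOf ℓ'

-- Interior vertices of the two paths of G between the endpoints of ℓ:
-- the path v_left, ..., v_right (not using e_r), and the path through e_r.
OnInnerPath : ∀ {n} → Link n → Fin n → Set
OnInnerPath ℓ x = (left ℓ < x) × (x < right ℓ)

OnOuterPath : ∀ {n} → Link n → Fin n → Set
OnOuterPath ℓ x = (x < left ℓ) ⊎ (right ℓ < x)

Cross : ∀ {n} → Link n → Link n → Set
Cross ℓ ℓ' = ¬ ShareEndpoint ℓ ℓ'
           × (∃ λ x → x isEndOf ℓ' × OnInnerPath ℓ x)
           × (∃ λ x → x isEndOf ℓ' × OnOuterPath ℓ x)

Intersect : ∀ {n} → Link n → Link n → Set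
Intersect ℓ ℓ' = ShareEndpoint ℓ ℓ' ⊎ Cross ℓ ℓ'

Adjacent : ∀ {p} → Fin p → Fin p → Set
Adjacent i j = (suc (toℕ i) ≡ toℕ j) ⊎ (suc (toℕ j) ≡ toℕ i)

-- X = {f 0, ..., f (p-1)} is a festoon and f is its festoon order:
-- the links are distinct, H[X] is the path visiting f 0, ..., f (p-1) in
-- this order (distinct links intersect iff they are consecutive), and
-- left and right endpoints are strictly increasing along the order.
record IsFestoon {n p : ℕ} (f : Fin p → Link n) : Set where
  field
    distinct  : ∀ i j → i ≢ j → f i ≢ f j
    path      : ∀ i j → i ≢ j → (Intersect (f i) (f j) ⇔ Adjacent i j)
    leftMono  : ∀ i j → i < j → left (f i) < left (f j)
    rightMono : ∀ i j → i < j → right (f i) < right (f j)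

{-# OPTIONS --safe #-}
module Submission where

open import Defs
open import Data.Nat using (ℕ; suc; _≥_)
open import Data.Fin using (Fin; toℕ; _<_)
import Data.Nat as N
import Data.Nat.Properties as ℕ
open import Data.Fin.Properties using (<-cmp; <⇒≢)
open import Data.Empty using (⊥-elim)
open import Data.Product using (_,_; _×_; ∃)
open import Data.Sum using (inj₁; inj₂)
open import Relation.Nullary using (¬_)
open import Relation.Binary.Definitions using (tri<; tri≈; tri>)
open import Relation.Binary.PropositionalEquality using (_≢_; refl)
open import Function.Bundles using (Equivalence)

-- With a < c and b < d, the only way to have c ≤ b is that the links
-- share the endpoint c = b or cross (c lies strictly between a and b,
-- d beyond b).
¬Intersect⇒right<left : ∀ {n} {ℓ ℓ′ : Link n} → ¬ Intersect ℓ ℓ′ →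
                        left ℓ < left ℓ′ → right ℓ < right ℓ′ →
                        right ℓ < left ℓ′
¬Intersect⇒right<left {ℓ = ℓ} {ℓ′} ¬int a<c b<d with <-cmp (right ℓ) (left ℓ′)
... | tri< b<c _ _ = b<c
... | tri≈ _ b≡c _ = ⊥-elim (¬int (inj₁ shared))
  where
  shared : ShareEndpoint ℓ ℓ′
  shared = right ℓ , inj₂ refl , inj₁ b≡c
... | tri> _ _ c<b = ⊥-elim (¬int (inj₂ (¬shared , inner , outer)))
  where
  ¬shared : ¬ ShareEndpoint ℓ ℓ′
  ¬shared sh = ¬int (inj₁ sh)
  inner : ∃ λ x → x isEndOf ℓ′ × OnInnerPath ℓ x
  inner = left ℓ′ , inj₁ refl , a<c , c<b
  outer : ∃ λ x → x isEndOf ℓ′ × OnOuterPath ℓ x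
  outer = right ℓ′ , inj₂ refl , inj₂ b<d

gap⇒¬Adjacent : ∀ {p} {i j : Fin p} → suc (toℕ i) N.< toℕ j → ¬ Adjacent i j
gap⇒¬Adjacent i+1<j (inj₁ i+1≡j) = ℕ.<-irrefl i+1≡j i+1<j
gap⇒¬Adjacent i+1<j (inj₂ j+1≡i) =
  ℕ.<-asym (ℕ.<-trans (ℕ.n<1+n _) i+1<j) (ℕ.≤-reflexive j+1≡i)

¬Adjacent⇒¬Intersect : ∀ {n p} {f : Fin p → Link n} → IsFestoon f →
                        ∀ {i j} → i ≢ j → ¬ Adjacent i j → ¬ Intersect (f i) (f j)
¬Adjacent⇒¬Intersect festoon {i} {j} i≢j ¬adj int =
  ¬adj (Equivalence.to (IsFestoon.path festoon i j i≢j) int)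

lemma34 : (n : ℕ) → n ≥ 3 → (p : ℕ) → (f : Fin p → Link n) → IsFestoon f →
    ∀ i j → suc (toℕ i) N.< toℕ j → right (f i) < left (f j)
lemma34 n _ p f festoon i j i+1<j =
  ¬Intersect⇒right<left {ℓ = f i} {f j}
    (¬Adjacent⇒¬Intersect festoon (<⇒≢ i<j) (gap⇒¬Adjacent i+1<j))
    (leftMono i j i<j) (rightMono i j i<j)
  where
  open IsFestoon festoon
  i<j : i < j
  i<j = ℕ.<-trans (ℕ.n<1+n (toℕ i)) i+1<j
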